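{- If $\mathscr{M}=(S,\rho)$ is a matroid scheme with no loops, then the characteristic polynomial of its poset of flats $F=F(\mathscr{M})$ is $\chi_F(t)=(-1)^{\rho(\mathscr{M})}T_{\mathscr{M}}(1-t,0)$.
   Context: Simplicial poset: finite, unique minimum $\hat0$, ranked, each $S_{\le x}$ Boolean on the atoms below $x$; $|x|$ the rank; $x\vee y$/$x\wedge y$ the sets of minimal common upper/maximal common lower bounds. Matroid scheme $(S,\rho)$: $\rho:S\to\mathbb{Z}_{\ge0}$ with (M1) $0\le\rho(x)\le|x|$; (M2) monotone; (M3) $u\in x\vee y\Rightarrow\rho(x)+\rho(y)\ge\rho(u)+\rho(x\wedge y)$; (M4) $\ell\in x\wedge y,\rho(x)=\rho(\ell)\Rightarrow x\vee y\ne\emptyset$; (M5) $\rho(x)<\rho(y)\Rightarrow$ some atom $a\le y$, $a\not\le x$, $x\vee a\ne\emptyset$. $\rho(\mathscr{M})$ is $\rho$ of any maximal element. A loop is an atom $a$ with $\rho(a)=0$. Closure $\mathrm{cl}(x)$: unique maximal $y\ge x$ with $\rho(y)=\rho(x)$; flats: $\mathrm{cl}(x)=x$; $F(\mathscr{M})$ the subposet of flats, ranked by $\rho$, with minimum $\mathrm{cl}(\hat0)$. Tutte polynomial: $T_{\mathscr{M}}(\mathrm{x},\mathrm{y})=\sum_{w\in S}(\mathrm{x}-1)^{\rho(\mathscr{M})-\rho(w)}(\mathrm{y}-1)^{|w|-\rho(w)}$. For a bounded-below ranked poset $(P,\rho)$, the Möbius function $\mu_P$ satisfies $\mu_P(\hat0)=1$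 and $\sum_{u\le w}\mu_P(u)=0$ for $w>\hat0$, and $\chi_P(t)=\sum_{w\in P}\mu_P(w)t^{\rho(P)-\rho(w)}$ where $\rho(P)$ is the rank of $P$ (for $P=F(\mathscr{M})$ this is $\rho(\mathscr{M})$). -}

module Defs where

open import Level using (0ℓ)
open import Data.Nat as ℕ using (ℕ; _∸_)
open import Data.Integer as ℤ using (ℤ; +_; -_; _+_; _*_; _^_)
open import Data.Fin using (Fin)
open import Data.Fin.Properties using (all?)
open import Data.List using (List; length; filter; map; foldr)
open import Data.Bool using (Bool; true)
open import Data.Product using (_×_; _,_; ∃; ∃-syntax)
open import Data.Sum using (_⊎_)
open import Data.Vec.Functional using ()
open import Data.List.Base using ()
open import Relation.Nullary using (¬_; Dec)
open import Relation.Nullary.Decidable using (_×-dec_; _→-dec_; ¬?)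
open import Relation.Binary using (Decidable)
open import Relation.Unary using (Pred)
open import Relation.Binary.PropositionalEquality using (_≡_; _≢_)
open import Function.Bundles using (_⇔_)
import Data.Fin as F
import Data.List as L

sumℤ : List ℤ → ℤ
sumℤ = foldr _+_ (+ 0)

Σ[_∣_]_ : (n : ℕ) {P : Pred (Fin n) 0ℓ} → (∀ x → Dec (P x)) → (Fin n → ℤ) → ℤ
Σ[ n ∣ P? ] f = sumℤ (map f (filter P? (L.allFin n)))

record FinPoset : Set₁ where
  field
    n       : ℕ
    _≼_     : Fin n → Fin n → Set
    _≼?_    : Decidable _≼_
    refl    : ∀ x → x ≼ x
    antisym : ∀ {x y} → x ≼ y → y ≼ x → x ≡ y
    trans   : ∀ {x y z} → x ≼ y → y ≼ z → x ≼ z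
    bot     : Fin n
    bot-min : ∀ x → bot ≼ x

  infix 4 _≼_ _≺_

  _≺_ : Fin n → Fin n → Set
  x ≺ y = x ≼ y × x ≢ y

  IsAtom : Fin n → Set
  IsAtom a = a ≢ bot × (∀ y → y ≼ a → y ≡ bot ⊎ y ≡ a)

  isAtom? : ∀ a → Dec (IsAtom a)
  isAtom? a = ¬? (a F.≟ bot) ×-dec all? (λ y → (y ≼? a) →-dec ((y F.≟ bot) ⊎-dec' (y F.≟ a)))
    where
    open import Relation.Nullary.Decidable using () renaming (_⊎-dec_ to _⊎-dec'_)

  -- |x| : the number of atoms below x (the rank in a simplicial poset)
  ∣_∣ : Fin n → ℕ
  ∣ x ∣ = length (filter (λ a → isAtom? a ×-dec (a ≼? x)) (L.allFin n))

  _∈_∨_ : Fin n → Fin n → Fin n → Set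
  u ∈ x ∨ y = (x ≼ u × y ≼ u) × (∀ v → x ≼ v → y ≼ v → v ≼ u → v ≡ u)

  _∈_∧_ : Fin n → Fin n → Fin n → Set
  ℓ ∈ x ∧ y = (ℓ ≼ x × ℓ ≼ y) × (∀ v → v ≼ x → v ≼ y → ℓ ≼ v → v ≡ ℓ)

  Joinable : Fin n → Fin n → Set
  Joinable x y = ∃[ u ] (u ∈ x ∨ y)

  IsMaximal : Fin n → Set
  IsMaximal m = ∀ y → m ≼ y → y ≡ m

-- Simplicial poset: each lower interval S_{≤x} is (order-isomorphic, via
-- y ↦ {atoms below y}) to the Boolean lattice of subsets of the atoms below x.
record IsSimplicial (P : FinPoset) : Set where
  open FinPoset P
  field
    boolean-order : ∀ x y z → y ≼ x → z ≼ x →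
                    (y ≼ z ⇔ (∀ a → IsAtom a → a ≼ y → a ≼ z))
    boolean-onto  : ∀ x (A : Fin n → Bool) →
                    (∀ a → A a ≡ true → IsAtom a × a ≼ x) →
                    ∃[ y ] (y ≼ x × (∀ a → IsAtom a → (a ≼ y ⇔ A a ≡ true)))

record MatroidScheme : Set₁ where
  field
    S          : FinPoset
    simplicial : IsSimplicial S
  open FinPoset S public
  field
    ρ  : Fin n → ℕ
    M1 : ∀ x → ρ x ℕ.≤ ∣ x ∣
    M2 : ∀ {x y} → x ≼ y → ρ x ℕ.≤ ρ y
    M3 : ∀ x y u ℓ → u ∈ x ∨ y → ℓ ∈ x ∧ y → ρ u ℕ.+ ρ ℓ ℕ.≤ ρ x ℕ.+ ρ y
    M4 : ∀ x y ℓ → ℓ ∈ x ∧ y → ρ x ≡ ρ ℓ → Joinable x y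
    M5 : ∀ x y → ρ x ℕ.< ρ y →
         ∃[ a ] (IsAtom a × a ≼ y × ¬ (a ≼ x) × Joinable x a)

  IsLoop : Fin n → Set
  IsLoop a = IsAtom a × ρ a ≡ 0

  -- IsClosure x y : y = cl(x), the greatest (= unique maximal, S finite)
  -- element among { z ≥ x | ρ z = ρ x }
  IsClosure : Fin n → Fin n → Set
  IsClosure x y = x ≼ y × ρ y ≡ ρ x × (∀ z → x ≼ z → ρ z ≡ ρ x → z ≼ y)

  IsFlat : Fin n → Set
  IsFlat x = IsClosure x x

  isFlat? : ∀ x → Dec (IsFlat x)
  isFlat? x = (x ≼? x) ×-dec ((ρ x ℕ.≟ ρ x) ×-dec
              all? (λ z → (x ≼? z) →-dec ((ρ z ℕ.≟ ρ x) →-dec (z ≼? x))))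

  -- Möbius function of the poset of flats F(M), whose minimum is c = cl(0̂):
  -- μ(c) = 1 and Σ_{u ∈ F, u ≤ w} μ(u) = 0 for every flat w > c.
  IsMobiusF : Fin n → (Fin n → ℤ) → Set
  IsMobiusF c μ = μ c ≡ + 1 ×
    (∀ w → IsFlat w → c ≺ w →
       Σ[ n ∣ (λ u → isFlat? u ×-dec (u ≼? w)) ] μ ≡ + 0)

  -- characteristic polynomial of F(M), with ρ(F) = ρ(M) = ρ m (m maximal in S)
  χF : (μ : Fin n → ℤ) (m : Fin n) (t : ℤ) → ℤ
  χF μ m t = Σ[ n ∣ isFlat? ] (λ w → μ w * t ^ (ρ m ∸ ρ w))

  Tutte : (m : Fin n) (x y : ℤ) → ℤ
  Tutte m x y = Σ[ n ∣ (λ _ → Relation.Nullary.yes Data.Unit.tt) ]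
    (λ w → (x ℤ.- + 1) ^ (ρ m ∸ ρ w) * (y ℤ.- + 1) ^ (∣ w ∣ ∸ ρ w))
    where import Relation.Nullary
          import Data.Unit

-- Without loops, cl 0̂ = 0̂ is the least flat. Put ν(G) = Σ_{cl w = G} (−1)^|w|. For a flat F,
-- w ≤ F iff cl w ≤ F, so the sum of ν over the flats below F is Σ_{w ≤ F} (−1)^|w|. Since the
-- poset is simplicial, [0̂, F] is Boolean, and toggling one atom below F is a sign-reversing
-- involution on it; the sum is therefore 1 if F = 0̂ and 0 otherwise. So ν satisfies the recursion
-- defining μ_F and agrees with μ on flats. Grouping the terms of χ_F by the fibres of cl gives
-- χ_F(t) = Σ_w (−1)^|w| t^(ρ(M) − ρ(w)), which is (−1)^ρ(M) T(1 − t, 0) term by term.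
-- Closures exist and are the least flats above by (M3) and (M4): if x ≤ y, x ≤ z and ρ y = ρ x,
-- then y and z have a common upper bound of rank ρ z.
module Submission where

open import Defs
open import Level using (Level; 0ℓ)
open import Algebra.Bundles using (Semiring)
open import Data.Bool as Bool using (Bool; true; false; if_then_else_; _∧_; _xor_)
open import Data.Bool.Properties using (xor-assoc; xor-same)
open import Data.Fin using (Fin; zero; suc; _≟_; punchIn)
open import Data.Fin.Permutation using (permutation)
open import Data.Fin.Properties using (punchInᵢ≢i; any?)
import Data.Integer.Properties as ℤP
open import Data.Integer.Solver using (module +-*-Solver)
open import Algebra.Properties.AbelianGroup ℤP.+-0-abelianGroup using (∙-cancelʳ)
open import Data.List as List using (List; []; _∷_; foldr; filter; allFin; length)
open import Data.List.Extrema.Nat using (argmax; argmax-all; f[xs]≤f[argmax])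
open import Data.List.Membership.Propositional.Properties using (∈-filter⁺; ∈-allFin)
open import Data.List.Properties using (map-tabulate; filter-none)
open import Data.List.Relation.Unary.All as All using ()
open import Data.List.Relation.Unary.All.Properties using (all-filter; tabulate⁺)
open import Data.Nat as ℕ using (ℕ; zero; suc; _≤_; _<_; _∸_; z≤n)
import Data.Nat.Properties as ℕP
open import Data.Product using (_×_; _,_; proj₁; proj₂; ∃-syntax)
open import Data.Unit using (tt)
open import Function using (_∘_; const)
open import Function.Bundles using (_⇔_; mk⇔; Equivalence)
open import Relation.Binary.PropositionalEquality as ≡
  using (_≡_; _≢_; refl; sym; trans; cong; cong₂; subst; subst₂)
open import Relation.Nullary using (¬_; Dec; yes; no; does; contradiction)
open import Relation.Nullary.Decidable using (dec-true; dec-false; does-⇔; decidable-stable; _×-dec_; ¬?)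
open import Relation.Unary using (Pred; Decidable)

private variable
  p : Level
  P Q : Set p

does-≡⇒⇔ : (P? : Dec P) (Q? : Dec Q) → does P? ≡ does Q? → P ⇔ Q
does-≡⇒⇔ (yes p) (yes q) _  = mk⇔ (const q) (const p)
does-≡⇒⇔ (no ¬p) (no ¬q) _  = mk⇔ (λ p → contradiction p ¬p) (λ q → contradiction q ¬q)

module FiniteSums {c ℓ} (R : Semiring c ℓ) where

  open Semiring R using (Carrier; _≈_; _+_; _*_; 0#; 1#; setoid; reflexive;
    +-cong; +-congˡ; +-congʳ; *-congˡ; zeroˡ; zeroʳ; +-identityˡ; +-identityʳ; *-identityˡ)
    renaming (refl to ≈-refl; sym to ≈-sym; trans to ≈-trans)
  open import Algebra.Properties.Semiring.Sum R public
  open import Relation.Binary.Reasoning.Setoid setoid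

  private variable
    m n : ℕ

  ⟦_⟧ : Dec P → Carrier
  ⟦ P? ⟧ = if does P? then 1# else 0#

  ⟦⟧-yes : (P? : Dec P) → P → ⟦ P? ⟧ ≡ 1#
  ⟦⟧-yes P? p = cong (if_then 1# else 0#) (dec-true P? p)

  ⟦⟧-no : (P? : Dec P) → ¬ P → ⟦ P? ⟧ ≡ 0#
  ⟦⟧-no P? ¬p = cong (if_then 1# else 0#) (dec-false P? ¬p)

  ⟦⟧-⇔ : P ⇔ Q → (P? : Dec P) (Q? : Dec Q) → ⟦ P? ⟧ ≡ ⟦ Q? ⟧
  ⟦⟧-⇔ P⇔Q P? Q? = cong (if_then 1# else 0#) (does-⇔ P⇔Q P? Q?)

  ⟦⟧*-yes : (P? : Dec P) {x : Carrier} → P → ⟦ P? ⟧ * x ≈ x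
  ⟦⟧*-yes P? {x} p = ≈-trans (reflexive (cong (_* x) (⟦⟧-yes P? p))) (*-identityˡ x)

  ⟦⟧*-no : (P? : Dec P) {x : Carrier} → ¬ P → ⟦ P? ⟧ * x ≈ 0#
  ⟦⟧*-no P? {x} ¬p = ≈-trans (reflexive (cong (_* x) (⟦⟧-no P? ¬p))) (zeroˡ x)

  ⟦⟧*-cong : (P? : Dec P) {x y : Carrier} → (P → x ≈ y) → ⟦ P? ⟧ * x ≈ ⟦ P? ⟧ * y
  ⟦⟧*-cong (yes p) x≈y = *-congˡ (x≈y p)
  ⟦⟧*-cong (no _)  _   = ≈-trans (zeroˡ _) (≈-sym (zeroˡ _))

  ∑-single : (f : Fin n → Carrier) (a : Fin n) → (∀ x → x ≢ a → f x ≈ 0#) → ∑[ x < n ] f x ≈ f a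
  ∑-single {suc n} f a vanishes = begin
    sum f                       ≈⟨ sum-remove {i = a} f ⟩
    f a + sum (f ∘ punchIn a)   ≈⟨ +-congˡ (sum-cong-≋ (λ x → vanishes _ (punchInᵢ≢i a x))) ⟩
    f a + ∑[ _ < n ] 0#         ≈⟨ +-congˡ (sum-replicate-zero n) ⟩
    f a + 0#                    ≈⟨ +-identityʳ (f a) ⟩
    f a                         ∎

  ∑-fibres : (φ : Fin m → Fin n) (h : Fin n → Carrier) (g : Fin m → Carrier) →
    ∑[ y < n ] (h y * ∑[ x < m ] (⟦ φ x ≟ y ⟧ * g x)) ≈ ∑[ x < m ] (h (φ x) * g x)
  ∑-fibres {m} {n} φ h g = begin
    ∑[ y < n ] (h y * ∑[ x < m ] (⟦ φ x ≟ y ⟧ * g x))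
      ≈⟨ sum-cong-≋ (λ y → *-distribˡ-sum (h y) (λ x → ⟦ φ x ≟ y ⟧ * g x)) ⟩
    ∑[ y < n ] ∑[ x < m ] (h y * (⟦ φ x ≟ y ⟧ * g x))
      ≈⟨ ∑-comm (λ y x → h y * (⟦ φ x ≟ y ⟧ * g x)) ⟩
    ∑[ x < m ] ∑[ y < n ] (h y * (⟦ φ x ≟ y ⟧ * g x))
      ≈⟨ sum-cong-≋ (λ x → ∑-single _ (φ x) (off-fibre x)) ⟩
    ∑[ x < m ] (h (φ x) * (⟦ φ x ≟ φ x ⟧ * g x))
      ≈⟨ sum-cong-≋ (λ x → *-congˡ (⟦⟧*-yes (φ x ≟ φ x) refl)) ⟩
    ∑[ x < m ] (h (φ x) * g x) ∎
    where
    off-fibre : ∀ x y → y ≢ φ x → h y * (⟦ φ x ≟ y ⟧ * g x) ≈ 0#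
    off-fibre x y y≢φx = ≈-trans (*-congˡ (⟦⟧*-no (φ x ≟ y) (y≢φx ∘ sym))) (zeroʳ (h y))

  ∑-involution : (τ : Fin n → Fin n) → (∀ x → τ (τ x) ≡ x) → (f : Fin n → Carrier) →
    ∑[ x < n ] f x ≈ ∑[ x < n ] f (τ x)
  ∑-involution τ τ-involutive f = ∑-permute f (permutation τ τ τ-involutive τ-involutive)

  foldr-filter : {A : Set} {P : Pred A p} (P? : Decidable P) (f : A → Carrier) (xs : List A) →
    foldr _+_ 0# (List.map f (filter P? xs)) ≈ foldr _+_ 0# (List.map (λ x → ⟦ P? x ⟧ * f x) xs)
  foldr-filter P? f []       = ≈-refl
  foldr-filter P? f (x ∷ xs) with P? x
  ... | yes _ = +-cong (≈-sym (*-identityˡ (f x))) (foldr-filter P? f xs)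
  ... | no _  = ≈-trans (foldr-filter P? f xs) (≈-sym (≈-trans (+-congʳ (zeroˡ (f x))) (+-identityˡ _)))

  foldr-tabulate : (f : Fin n → Carrier) → foldr _+_ 0# (List.tabulate f) ≡ ∑[ x < n ] f x
  foldr-tabulate {zero}  f = refl
  foldr-tabulate {suc n} f = cong (f zero +_) (foldr-tabulate (f ∘ suc))

  foldr-filter-allFin : {P : Pred (Fin n) p} (P? : Decidable P) (f : Fin n → Carrier) →
    foldr _+_ 0# (List.map f (filter P? (allFin n))) ≈ ∑[ x < n ] (⟦ P? x ⟧ * f x)
  foldr-filter-allFin {n} P? f = begin
    foldr _+_ 0# (List.map f (filter P? (allFin n)))
      ≈⟨ foldr-filter P? f (allFin n) ⟩
    foldr _+_ 0# (List.map (λ x → ⟦ P? x ⟧ * f x) (allFin n))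
      ≡⟨ cong (foldr _+_ 0#) (map-tabulate (λ (x : Fin n) → x) _) ⟩
    foldr _+_ 0# (List.tabulate (λ x → ⟦ P? x ⟧ * f x))
      ≡⟨ foldr-tabulate (λ x → ⟦ P? x ⟧ * f x) ⟩
    ∑[ x < n ] (⟦ P? x ⟧ * f x) ∎

module ℕΣ = FiniteSums ℕP.+-*-semiring

∑-mono-≤ : ∀ {n} {f g : Fin n → ℕ} → (∀ x → f x ≤ g x) → ℕΣ.sum f ≤ ℕΣ.sum g
∑-mono-≤ {zero}  _   = z≤n
∑-mono-≤ {suc n} f≤g = ℕP.+-mono-≤ (f≤g zero) (∑-mono-≤ (f≤g ∘ suc))

∑-mono-< : ∀ {n} {f g : Fin n → ℕ} (a : Fin n) → (∀ x → f x ≤ g x) → f a < g a → ℕΣ.sum f < ℕΣ.sum g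
∑-mono-< {suc n} {f} {g} a f≤g fa<ga = begin-strict
  ℕΣ.sum f                       ≡⟨ ℕΣ.sum-remove {i = a} f ⟩
  f a ℕ.+ ℕΣ.sum (f ∘ punchIn a) <⟨ ℕP.+-mono-<-≤ fa<ga (∑-mono-≤ (f≤g ∘ punchIn a)) ⟩
  g a ℕ.+ ℕΣ.sum (g ∘ punchIn a) ≡⟨ ℕΣ.sum-remove {i = a} g ⟨
  ℕΣ.sum g                       ∎
  where open ℕP.≤-Reasoning

⟦⟧-mono : (P? : Dec P) (Q? : Dec Q) → (P → Q) → ℕΣ.⟦ P? ⟧ ≤ ℕΣ.⟦ Q? ⟧
⟦⟧-mono (no _)  _       _   = z≤n
⟦⟧-mono (yes _) (yes _) _   = ℕP.≤-refl
⟦⟧-mono (yes p) (no ¬q) P→Q = contradiction (P→Q p) ¬q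

length-filter-allFin : ∀ {n} {P : Pred (Fin n) p} (P? : Decidable P) →
  length (filter P? (allFin n)) ≡ ℕΣ.sum (λ x → ℕΣ.⟦ P? x ⟧)
length-filter-allFin {n = n} P? = begin
  length (filter P? (allFin n))                             ≡⟨ length≡∑1 (filter P? (allFin n)) ⟩
  foldr ℕ._+_ 0 (List.map (const 1) (filter P? (allFin n))) ≡⟨ ℕΣ.foldr-filter-allFin P? (const 1) ⟩
  ℕΣ.sum (λ x → ℕΣ.⟦ P? x ⟧ ℕ.* 1)                          ≡⟨ ℕΣ.sum-cong-≗ (λ x → ℕP.*-identityʳ ℕΣ.⟦ P? x ⟧) ⟩
  ℕΣ.sum (λ x → ℕΣ.⟦ P? x ⟧)                                ∎
  where
  open ≡.≡-Reasoning
  length≡∑1 : {A : Set} (xs : List A) → length xs ≡ foldr ℕ._+_ 0 (List.map (const 1) xs)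
  length≡∑1 []       = refl
  length≡∑1 (_ ∷ xs) = cong suc (length≡∑1 xs)

-- Opened only here: inside FiniteSums these operators would clash with the semiring's.
open import Data.Integer as ℤ using (ℤ; +_; -_; _+_; _*_; _-_; _^_; 0ℤ; 1ℤ; -1ℤ)
open FiniteSums ℤP.+-*-semiring

∑-neg : ∀ {n} (f : Fin n → ℤ) → ∑[ x < n ] (- f x) ≡ - ∑[ x < n ] f x
∑-neg f = begin
  sum (λ x → - f x)         ≡⟨ sum-cong-≗ (λ x → sym (ℤP.-1*i≡-i (f x))) ⟩
  sum (λ x → -1ℤ * f x)     ≡⟨ *-distribˡ-sum -1ℤ f ⟨
  -1ℤ * sum f               ≡⟨ ℤP.-1*i≡-i (sum f) ⟩
  - sum f                   ∎
  where open ≡.≡-Reasoning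

∑-agree-off⇒agree-at : ∀ {n} (f g : Fin n → ℤ) (a : Fin n) →
  (∀ x → x ≢ a → f x ≡ g x) → sum f ≡ sum g → f a ≡ g a
∑-agree-off⇒agree-at {suc n} f g a agree ∑f≡∑g = ∙-cancelʳ (sum (g ∘ punchIn a)) (f a) (g a) (begin
  f a + sum (g ∘ punchIn a)   ≡⟨ cong (λ s → f a + s) (sum-cong-≗ (λ x → agree _ (punchInᵢ≢i a x))) ⟨
  f a + sum (f ∘ punchIn a)   ≡⟨ sum-remove {i = a} f ⟨
  sum f                       ≡⟨ ∑f≡∑g ⟩
  sum g                       ≡⟨ sum-remove {i = a} g ⟩
  g a + sum (g ∘ punchIn a)   ∎)
  where open ≡.≡-Reasoning

i≡-i⇒i≡0 : ∀ i → i ≡ - i → i ≡ 0ℤ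
i≡-i⇒i≡0 (+ zero)  _  = refl
i≡-i⇒i≡0 (+ suc _) ()
i≡-i⇒i≡0 ℤ.-[1+ _ ] ()

neg-^ : ∀ t p → (- t) ^ p ≡ -1ℤ ^ p * t ^ p
neg-^ t zero    = refl
neg-^ t (suc p) = begin
  - t * (- t) ^ p
    ≡⟨ cong₂ _*_ (sym (ℤP.-1*i≡-i t)) (neg-^ t p) ⟩
  -1ℤ * t * (-1ℤ ^ p * t ^ p)
    ≡⟨ solve 3 (λ t a b → con -1ℤ :* t :* (a :* b) := con -1ℤ :* a :* (t :* b)) refl t (-1ℤ ^ p) (t ^ p) ⟩
  -1ℤ * -1ℤ ^ p * (t * t ^ p) ∎
  where open ≡.≡-Reasoning
        open +-*-Solver

-1^p*-1^p≡1 : ∀ p → -1ℤ ^ p * -1ℤ ^ p ≡ 1ℤ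
-1^p*-1^p≡1 p = trans (sym (neg-^ -1ℤ p)) (ℤP.^-zeroˡ p)

tutte-summand-at-1-t : ∀ s p q t →
  -1ℤ ^ (s ℕ.+ p) * ((1ℤ - t - 1ℤ) ^ p * (0ℤ - 1ℤ) ^ q) ≡ -1ℤ ^ (s ℕ.+ q) * t ^ p
tutte-summand-at-1-t s p q t = begin
  -1ℤ ^ (s ℕ.+ p) * ((1ℤ - t - 1ℤ) ^ p * (0ℤ - 1ℤ) ^ q)
    ≡⟨ cong₂ (λ x y → x * (y * -1ℤ ^ q)) (ℤP.^-distribˡ-+-* -1ℤ s p) (trans (cong (_^ p) 1-t-1≡-t) (neg-^ t p)) ⟩
  -1ℤ ^ s * -1ℤ ^ p * (-1ℤ ^ p * t ^ p * -1ℤ ^ q)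
    ≡⟨ solve 4 (λ a b c d → a :* b :* (b :* c :* d) := a :* d :* c :* (b :* b)) refl (-1ℤ ^ s) (-1ℤ ^ p) (t ^ p) (-1ℤ ^ q) ⟩
  -1ℤ ^ s * -1ℤ ^ q * t ^ p * (-1ℤ ^ p * -1ℤ ^ p)
    ≡⟨ cong (λ x → -1ℤ ^ s * -1ℤ ^ q * t ^ p * x) (-1^p*-1^p≡1 p) ⟩
  -1ℤ ^ s * -1ℤ ^ q * t ^ p * 1ℤ
    ≡⟨ ℤP.*-identityʳ _ ⟩
  -1ℤ ^ s * -1ℤ ^ q * t ^ p
    ≡⟨ cong (_* t ^ p) (ℤP.^-distribˡ-+-* -1ℤ s q) ⟨
  -1ℤ ^ (s ℕ.+ q) * t ^ p
    ∎
  where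
  open ≡.≡-Reasoning
  open +-*-Solver
  1-t-1≡-t : 1ℤ - t - 1ℤ ≡ - t
  1-t-1≡-t = solve 1 (λ t → con 1ℤ :- t :- con 1ℤ := :- t) refl t

module SimplicialPoset (P : FinPoset) (simplicial : IsSimplicial P) where

  open FinPoset P renaming (refl to ≼-refl; trans to ≼-trans)
  open IsSimplicial simplicial

  private variable
    x y z w : Fin n

  ≼bot⇒≡bot : x ≼ bot → x ≡ bot
  ≼bot⇒≡bot {x} x≼bot = antisym x≼bot (bot-min x)

  ≼-from-atoms : y ≼ x → z ≼ x → (∀ a → IsAtom a → a ≼ y → a ≼ z) → y ≼ z
  ≼-from-atoms {y} {x} {z} y≼x z≼x = Equivalence.from (boolean-order x y z y≼x z≼x)

  ≡-from-atoms : y ≼ x → z ≼ x → (∀ a → IsAtom a → does (a ≼? y) ≡ does (a ≼? z)) → y ≡ z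
  ≡-from-atoms {y = y} {z = z} y≼x z≼x same = antisym
    (≼-from-atoms y≼x z≼x (λ a atom → Equivalence.to (same-atom a atom)))
    (≼-from-atoms z≼x y≼x (λ a atom → Equivalence.from (same-atom a atom)))
    where
    same-atom : ∀ a → IsAtom a → a ≼ y ⇔ a ≼ z
    same-atom a atom = does-≡⇒⇔ (a ≼? y) (a ≼? z) (same a atom)

  atom-separating : y ≼ x → ¬ x ≼ y → ∃[ a ] (IsAtom a × a ≼ x × ¬ a ≼ y)
  atom-separating {y} {x} y≼x x⋠y with any? (λ a → isAtom? a ×-dec a ≼? x ×-dec ¬? (a ≼? y))
  ... | yes separating = separating
  ... | no ∄separating = contradiction (≼-from-atoms (≼-refl x) y≼x below-y) x⋠y
    where
    below-y : ∀ a → IsAtom a → a ≼ x → a ≼ y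
    below-y a atom a≼x = decidable-stable (a ≼? y) (λ a⋠y → ∄separating (a , atom , a≼x , a⋠y))

  atom-below? : ∀ x a → Dec (IsAtom a × a ≼ x)
  atom-below? x a = isAtom? a ×-dec a ≼? x

  ∣∣-as-sum : ∀ x → ∣ x ∣ ≡ ℕΣ.sum (λ a → ℕΣ.⟦ atom-below? x a ⟧)
  ∣∣-as-sum x = length-filter-allFin (atom-below? x)

  ∣bot∣≡0 : ∣ bot ∣ ≡ 0
  ∣bot∣≡0 = cong length (filter-none (atom-below? bot)
    (tabulate⁺ {f = λ a → a} (λ a (atom , a≼bot) → proj₁ atom (≼bot⇒≡bot a≼bot))))

  ∣∣-mono-< : y ≼ x → y ≢ x → ∣ y ∣ < ∣ x ∣
  ∣∣-mono-< {y} {x} y≼x y≢x with atom-separating y≼x (y≢x ∘ antisym y≼x)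
  ... | a , atom , a≼x , a⋠y =
    subst₂ _<_ (sym (∣∣-as-sum y)) (sym (∣∣-as-sum x)) (∑-mono-< a pointwise-≤ strict-at-a)
    where
    pointwise-≤ : ∀ b → ℕΣ.⟦ atom-below? y b ⟧ ≤ ℕΣ.⟦ atom-below? x b ⟧
    pointwise-≤ b = ⟦⟧-mono (atom-below? y b) (atom-below? x b) (λ (atom , b≼y) → atom , ≼-trans b≼y y≼x)
    strict-at-a : ℕΣ.⟦ atom-below? y a ⟧ < ℕΣ.⟦ atom-below? x a ⟧
    strict-at-a = subst₂ _<_ (sym (ℕΣ.⟦⟧-no (atom-below? y a) (a⋠y ∘ proj₂)))
                             (sym (ℕΣ.⟦⟧-yes (atom-below? x a) (atom , a≼x))) ℕP.0<1+n

  -- Opaque, so that the argmax witness is never unfolded in later conversion checks.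
  opaque
    exists-maximal : {Q : Pred (Fin n) 0ℓ} → Decidable Q → Q x →
      ∃[ y ] (Q y × (∀ z → Q z → y ≼ z → z ≡ y))
    exists-maximal {x} {Q} Q? Qx = best , Q-best , maximal
      where
      candidates : List (Fin n)
      candidates = filter Q? (allFin n)
      best : Fin n
      best = argmax ∣_∣ x candidates
      Q-best : Q best
      Q-best = argmax-all ∣_∣ Qx (all-filter Q? (allFin n))
      maximal : ∀ z → Q z → best ≼ z → z ≡ best
      maximal z Qz best≼z with z ≟ best
      ... | yes z≡best = z≡best
      ... | no z≢best  = contradiction
        (All.lookup (f[xs]≤f[argmax] x candidates) (∈-filter⁺ Q? (∈-allFin z) Qz))
        (ℕP.<⇒≱ (∣∣-mono-< best≼z (z≢best ∘ sym)))

  meet-above : x ≼ y → x ≼ z → ∃[ ℓ ] (ℓ ∈ y ∧ z × x ≼ ℓ)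
  meet-above {x} {y} {z} x≼y x≼z
    with exists-maximal (λ v → v ≼? y ×-dec v ≼? z ×-dec x ≼? v) (x≼y , x≼z , ≼-refl x)
  ... | ℓ , (ℓ≼y , ℓ≼z , x≼ℓ) , maximal =
    ℓ , ((ℓ≼y , ℓ≼z) , λ v v≼y v≼z ℓ≼v → maximal v (v≼y , v≼z , ≼-trans x≼ℓ ℓ≼v) ℓ≼v) , x≼ℓ

  lower-sums-determine : {Q : Pred (Fin n) 0ℓ} (Q? : Decidable Q) (f g : Fin n → ℤ) →
    (∀ x → Q x → ∑[ y < n ] (⟦ Q? y ×-dec y ≼? x ⟧ * f y) ≡ ∑[ y < n ] (⟦ Q? y ×-dec y ≼? x ⟧ * g y)) →
    ∀ x → Q x → f x ≡ g x
  lower-sums-determine {Q} Q? f g same-sums x = determined (suc ∣ x ∣) x ℕP.≤-refl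
    where
    determined : ∀ k x → ∣ x ∣ < k → Q x → f x ≡ g x
    determined (suc k) x ∣x∣<1+k Qx = begin
      f x                          ≡⟨ ⟦⟧*-yes (Q? x ×-dec x ≼? x) (Qx , ≼-refl x) ⟨
      ⟦ Q? x ×-dec x ≼? x ⟧ * f x  ≡⟨ ∑-agree-off⇒agree-at _ _ x below-x (same-sums x Qx) ⟩
      ⟦ Q? x ×-dec x ≼? x ⟧ * g x  ≡⟨ ⟦⟧*-yes (Q? x ×-dec x ≼? x) (Qx , ≼-refl x) ⟩
      g x                          ∎
      where
      open ≡.≡-Reasoning
      below-x : ∀ y → y ≢ x → ⟦ Q? y ×-dec y ≼? x ⟧ * f y ≡ ⟦ Q? y ×-dec y ≼? x ⟧ * g y
      below-x y y≢x = ⟦⟧*-cong (Q? y ×-dec y ≼? x) λ (Qy , y≼x) →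
        determined k y (ℕP.<-≤-trans (∣∣-mono-< y≼x y≢x) (ℕP.≤-pred ∣x∣<1+k)) Qy

  sign : Fin n → ℤ
  sign x = -1ℤ ^ ∣ x ∣

  sign-flip : ∣ x ∣ ≡ suc ∣ y ∣ → sign x ≡ - sign y
  sign-flip {y = y} ∣x∣≡1+∣y∣ = trans (cong (-1ℤ ^_) ∣x∣≡1+∣y∣) (ℤP.-1*i≡-i (sign y))

  module Toggle {F a : Fin n} (a-atom : IsAtom a) (a≼F : a ≼ F) where

    toggled : Fin n → Fin n → Bool
    toggled w b = does (isAtom? b) ∧ (does (b ≟ a) xor does (b ≼? w))

    toggled⇒atom-below-F : w ≼ F → ∀ b → toggled w b ≡ true → IsAtom b × b ≼ F
    toggled⇒atom-below-F {w} w≼F b = below-F (isAtom? b) (b ≟ a) (b ≼? w)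
      where
      below-F : (atom? : Dec (IsAtom b)) (b≟a : Dec (b ≡ a)) (b≼?w : Dec (b ≼ w)) →
                does atom? ∧ (does b≟a xor does b≼?w) ≡ true → IsAtom b × b ≼ F
      below-F (yes atom) (yes refl) _         _ = atom , a≼F
      below-F (yes atom) (no _)     (yes b≼w) _ = atom , ≼-trans b≼w w≼F
      below-F (yes _)    (no _)     (no _)    ()
      below-F (no _)     _          _         ()

    TogglesAtom : Fin n → Fin n → Set
    TogglesAtom w y = y ≼ F × (∀ b → IsAtom b → does (b ≼? y) ≡ does (b ≟ a) xor does (b ≼? w))

    toggle : w ≼ F → ∃[ y ] TogglesAtom w y
    toggle {w} w≼F with boolean-onto F (toggled w) (toggled⇒atom-below-F w≼F)
    ... | y , y≼F , atoms-of-y = y , y≼F , λ b atom → begin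
      does (b ≼? y)                     ≡⟨ does-⇔ (atoms-of-y b atom) (b ≼? y) (toggled w b Bool.≟ true) ⟩
      does (toggled w b Bool.≟ true)    ≡⟨ does-≟-true (toggled w b) ⟩
      toggled w b                       ≡⟨ cong (_∧ (does (b ≟ a) xor does (b ≼? w))) (dec-true (isAtom? b) atom) ⟩
      does (b ≟ a) xor does (b ≼? w)    ∎
      where
      open ≡.≡-Reasoning
      does-≟-true : ∀ t → does (t Bool.≟ true) ≡ t
      does-≟-true true  = refl
      does-≟-true false = refl

    τ : Fin n → Fin n
    τ w with w ≼? F
    ... | yes w≼F = proj₁ (toggle w≼F)
    ... | no _    = w

    τ-toggles : w ≼ F → TogglesAtom w (τ w)
    τ-toggles {w} w≼F with w ≼? F
    ... | yes w≼F′ = proj₂ (toggle w≼F′)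
    ... | no w⋠F   = contradiction w≼F w⋠F

    τ-outside : ¬ w ≼ F → τ w ≡ w
    τ-outside {w} w⋠F with w ≼? F
    ... | yes w≼F = contradiction w≼F w⋠F
    ... | no _    = refl

    τ-involutive : ∀ w → τ (τ w) ≡ w
    τ-involutive w = involutive (w ≼? F)
      where
      involutive : Dec (w ≼ F) → τ (τ w) ≡ w
      involutive (no w⋠F)  = trans (cong τ (τ-outside w⋠F)) (τ-outside w⋠F)
      involutive (yes w≼F) =
        let τw≼F , τw-atoms = τ-toggles w≼F
            ττw≼F , ττw-atoms = τ-toggles τw≼F
        in ≡-from-atoms ττw≼F w≼F λ b atom → begin
          does (b ≼? τ (τ w))                               ≡⟨ ττw-atoms b atom ⟩
          does (b ≟ a) xor does (b ≼? τ w)                  ≡⟨ cong (does (b ≟ a) xor_) (τw-atoms b atom) ⟩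
          does (b ≟ a) xor (does (b ≟ a) xor does (b ≼? w)) ≡⟨ xor-assoc (does (b ≟ a)) _ _ ⟨
          (does (b ≟ a) xor does (b ≟ a)) xor does (b ≼? w) ≡⟨ cong (_xor does (b ≼? w)) (xor-same (does (b ≟ a))) ⟩
          does (b ≼? w)                                     ∎
        where open ≡.≡-Reasoning

    ∣τ∣≡1+∣∣ : w ≼ F → ¬ a ≼ w → ∣ τ w ∣ ≡ suc ∣ w ∣
    ∣τ∣≡1+∣∣ {w} w≼F a⋠w = begin
      ∣ τ w ∣
        ≡⟨ ∣∣-as-sum (τ w) ⟩
      ℕΣ.sum (λ b → ℕΣ.⟦ atom-below? (τ w) b ⟧)
        ≡⟨ ℕΣ.sum-cong-≗ count ⟩
      ℕΣ.sum (λ b → ℕΣ.⟦ b ≟ a ⟧ ℕ.+ ℕΣ.⟦ atom-below? w b ⟧)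
        ≡⟨ ℕΣ.∑-distrib-+ (λ b → ℕΣ.⟦ b ≟ a ⟧) _ ⟩
      ℕΣ.sum (λ b → ℕΣ.⟦ b ≟ a ⟧) ℕ.+ ℕΣ.sum (λ b → ℕΣ.⟦ atom-below? w b ⟧)
        ≡⟨ cong₂ ℕ._+_ (ℕΣ.∑-single _ a (λ b → ℕΣ.⟦⟧-no (b ≟ a))) (sym (∣∣-as-sum w)) ⟩
      ℕΣ.⟦ a ≟ a ⟧ ℕ.+ ∣ w ∣
        ≡⟨ cong (ℕ._+ ∣ w ∣) (ℕΣ.⟦⟧-yes (a ≟ a) refl) ⟩
      suc ∣ w ∣ ∎
      where
      open ≡.≡-Reasoning
      atom-below⇔below : ∀ {b} x → IsAtom b → (IsAtom b × b ≼ x) ⇔ b ≼ x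
      atom-below⇔below x atom = mk⇔ proj₂ (atom ,_)
      count : ∀ b → ℕΣ.⟦ atom-below? (τ w) b ⟧ ≡ ℕΣ.⟦ b ≟ a ⟧ ℕ.+ ℕΣ.⟦ atom-below? w b ⟧
      count b = counted (isAtom? b)
        where
        toggled-count : (b≟a : Dec (b ≡ a)) →
          (if does b≟a xor does (b ≼? w) then 1 else 0) ≡ ℕΣ.⟦ b≟a ⟧ ℕ.+ ℕΣ.⟦ b ≼? w ⟧
        toggled-count (yes refl) rewrite dec-false (a ≼? w) a⋠w = refl
        toggled-count (no _)     = refl
        counted : Dec (IsAtom b) → ℕΣ.⟦ atom-below? (τ w) b ⟧ ≡ ℕΣ.⟦ b ≟ a ⟧ ℕ.+ ℕΣ.⟦ atom-below? w b ⟧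
        counted (no ¬atom) = begin
          ℕΣ.⟦ atom-below? (τ w) b ⟧
            ≡⟨ ℕΣ.⟦⟧-no (atom-below? (τ w) b) (¬atom ∘ proj₁) ⟩
          0
            ≡⟨ cong₂ ℕ._+_ (ℕΣ.⟦⟧-no (b ≟ a) (λ { refl → ¬atom a-atom }))
                           (ℕΣ.⟦⟧-no (atom-below? w b) (¬atom ∘ proj₁)) ⟨
          ℕΣ.⟦ b ≟ a ⟧ ℕ.+ ℕΣ.⟦ atom-below? w b ⟧ ∎
        counted (yes atom) = begin
          ℕΣ.⟦ atom-below? (τ w) b ⟧
            ≡⟨ ℕΣ.⟦⟧-⇔ (atom-below⇔below (τ w) atom) (atom-below? (τ w) b) (b ≼? τ w) ⟩
          ℕΣ.⟦ b ≼? τ w ⟧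
            ≡⟨ cong (if_then 1 else 0) (proj₂ (τ-toggles w≼F) b atom) ⟩
          (if does (b ≟ a) xor does (b ≼? w) then 1 else 0)
            ≡⟨ toggled-count (b ≟ a) ⟩
          ℕΣ.⟦ b ≟ a ⟧ ℕ.+ ℕΣ.⟦ b ≼? w ⟧
            ≡⟨ cong (ℕΣ.⟦ b ≟ a ⟧ ℕ.+_) (ℕΣ.⟦⟧-⇔ (atom-below⇔below w atom) (atom-below? w b) (b ≼? w)) ⟨
          ℕΣ.⟦ b ≟ a ⟧ ℕ.+ ℕΣ.⟦ atom-below? w b ⟧ ∎

    sign-τ : w ≼ F → sign (τ w) ≡ - sign w
    sign-τ {w} w≼F with a ≼? w
    ... | no a⋠w  = sign-flip (∣τ∣≡1+∣∣ w≼F a⋠w)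
    ... | yes a≼w = begin
      sign (τ w)     ≡⟨ ℤP.neg-involutive (sign (τ w)) ⟨
      - - sign (τ w) ≡⟨ cong -_ (sign-flip ∣w∣≡1+∣τw∣) ⟨
      - sign w       ∎
      where
      open ≡.≡-Reasoning
      τw≼F : τ w ≼ F
      τw≼F = proj₁ (τ-toggles w≼F)
      a⋠τw : ¬ a ≼ τ w
      a⋠τw a≼τw = contradiction (begin
        true                               ≡⟨ dec-true (a ≼? τ w) a≼τw ⟨
        does (a ≼? τ w)                    ≡⟨ proj₂ (τ-toggles w≼F) a a-atom ⟩
        does (a ≟ a) xor does (a ≼? w)     ≡⟨ cong₂ _xor_ (dec-true (a ≟ a) refl) (dec-true (a ≼? w) a≼w) ⟩
        false                              ∎) λ ()
      ∣w∣≡1+∣τw∣ : ∣ w ∣ ≡ suc ∣ τ w ∣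
      ∣w∣≡1+∣τw∣ = trans (cong ∣_∣ (sym (τ-involutive w))) (∣τ∣≡1+∣∣ τw≼F a⋠τw)

    ∑-sign-below-F : ∑[ w < n ] (⟦ w ≼? F ⟧ * sign w) ≡ 0ℤ
    ∑-sign-below-F = i≡-i⇒i≡0 _ (begin
      sum signed-below-F          ≡⟨ ∑-involution τ τ-involutive signed-below-F ⟩
      sum (signed-below-F ∘ τ)    ≡⟨ sum-cong-≗ (λ w → τ-negates w (w ≼? F)) ⟩
      sum (-_ ∘ signed-below-F)   ≡⟨ ∑-neg signed-below-F ⟩
      - sum signed-below-F        ∎)
      where
      open ≡.≡-Reasoning
      signed-below-F : Fin n → ℤ
      signed-below-F w = ⟦ w ≼? F ⟧ * sign w
      τ-negates : ∀ w (w≼?F : Dec (w ≼ F)) → ⟦ τ w ≼? F ⟧ * sign (τ w) ≡ - (⟦ w≼?F ⟧ * sign w)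
      τ-negates w (yes w≼F) = begin
        ⟦ τ w ≼? F ⟧ * sign (τ w)   ≡⟨ ⟦⟧*-yes (τ w ≼? F) (proj₁ (τ-toggles w≼F)) ⟩
        sign (τ w)                  ≡⟨ sign-τ w≼F ⟩
        - sign w                    ≡⟨ cong -_ (ℤP.*-identityˡ (sign w)) ⟨
        - (1ℤ * sign w)             ∎
      τ-negates w (no w⋠F) = begin
        ⟦ τ w ≼? F ⟧ * sign (τ w)   ≡⟨ cong (λ v → ⟦ v ≼? F ⟧ * sign v) (τ-outside w⋠F) ⟩
        ⟦ w ≼? F ⟧ * sign w         ≡⟨ ⟦⟧*-no (w ≼? F) w⋠F ⟩
        0ℤ                          ∎

  ∑-sign-below : ∀ F → ∑[ w < n ] (⟦ w ≼? F ⟧ * sign w) ≡ ⟦ F ≟ bot ⟧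
  ∑-sign-below F with F ≟ bot
  ... | yes refl = begin
    ∑[ w < n ] (⟦ w ≼? bot ⟧ * sign w)   ≡⟨ ∑-single _ bot (λ w w≢bot → ⟦⟧*-no (w ≼? bot) (w≢bot ∘ ≼bot⇒≡bot)) ⟩
    ⟦ bot ≼? bot ⟧ * sign bot            ≡⟨ ⟦⟧*-yes (bot ≼? bot) (≼-refl bot) ⟩
    -1ℤ ^ ∣ bot ∣                        ≡⟨ cong (-1ℤ ^_) ∣bot∣≡0 ⟩
    1ℤ                                   ∎
    where open ≡.≡-Reasoning
  ... | no F≢bot with atom-separating (bot-min F) (F≢bot ∘ ≼bot⇒≡bot)
  ...   | a , a-atom , a≼F , _ = Toggle.∑-sign-below-F a-atom a≼F

module Closure (M : MatroidScheme) where

  open MatroidScheme M renaming (refl to ≼-refl; trans to ≼-trans)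
  open SimplicialPoset S simplicial

  private variable
    x y z w F m : Fin n

  ρ≤ρ-maximal : IsMaximal m → ∀ w → ρ w ≤ ρ m
  ρ≤ρ-maximal {m} m-maximal w = ℕP.≮⇒≥ λ ρm<ρw →
    let a , _ , _ , a⋠m , u , (m≼u , a≼u) , _ = M5 m w ρm<ρw
    in a⋠m (subst (a ≼_) (m-maximal u m≼u) a≼u)

  rank-sandwich : x ≼ y → y ≼ z → ρ z ≡ ρ x → ρ y ≡ ρ z
  rank-sandwich {y = y} x≼y y≼z ρz≡ρx = ℕP.≤-antisym (M2 y≼z) (subst (_≤ ρ y) (sym ρz≡ρx) (M2 x≼y))

  rank-preserving-join : x ≼ y → x ≼ z → ρ y ≡ ρ x → ∃[ u ] (y ≼ u × z ≼ u × ρ u ≡ ρ z)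
  rank-preserving-join {x} {y} {z} x≼y x≼z ρy≡ρx with meet-above x≼y x≼z
  ... | ℓ , ℓ∈y∧z@((ℓ≼y , _) , _) , x≼ℓ
      with M4 y z ℓ ℓ∈y∧z (sym (rank-sandwich x≼ℓ ℓ≼y ρy≡ρx))
  ... | u , u∈y∨z@((y≼u , z≼u) , _) = u , y≼u , z≼u , ℕP.≤-antisym ρu≤ρz (M2 z≼u)
    where
    ρu≤ρz : ρ u ≤ ρ z
    ρu≤ρz = ℕP.+-cancelʳ-≤ (ρ y) (ρ u) (ρ z)
      (subst₂ _≤_ (cong (ρ u ℕ.+_) (rank-sandwich x≼ℓ ℓ≼y ρy≡ρx)) (ℕP.+-comm (ρ y) (ρ z))
        (M3 y z u ℓ u∈y∨z ℓ∈y∧z))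

  maximal⇒closure : x ≼ y → ρ y ≡ ρ x → (∀ z → x ≼ z × ρ z ≡ ρ x → y ≼ z → z ≡ y) → IsClosure x y
  maximal⇒closure {x} {y} x≼y ρy≡ρx maximal = x≼y , ρy≡ρx , greatest
    where
    greatest : ∀ z → x ≼ z → ρ z ≡ ρ x → z ≼ y
    greatest z x≼z ρz≡ρx =
      let u , y≼u , z≼u , ρu≡ρz = rank-preserving-join x≼y x≼z ρy≡ρx
      in subst (z ≼_) (maximal u (≼-trans x≼y y≼u , trans ρu≡ρz ρz≡ρx) y≼u) z≼u

  closure : ∀ x → ∃[ y ] IsClosure x y
  closure x with exists-maximal (λ z → x ≼? z ×-dec ρ z ℕ.≟ ρ x) (≼-refl x , refl)
  ... | y , (x≼y , ρy≡ρx) , maximal = y , maximal⇒closure x≼y ρy≡ρx maximal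

  cl : Fin n → Fin n
  cl x = proj₁ (closure x)

  ≼-cl : ∀ x → x ≼ cl x
  ≼-cl x = proj₁ (proj₂ (closure x))

  ρ-cl : ∀ x → ρ (cl x) ≡ ρ x
  ρ-cl x = proj₁ (proj₂ (proj₂ (closure x)))

  cl-flat : ∀ x → IsFlat (cl x)
  cl-flat x = ≼-refl (cl x) , refl , λ z cl≼z ρz≡ρcl →
    proj₂ (proj₂ (proj₂ (closure x))) z (≼-trans (≼-cl x) cl≼z) (trans ρz≡ρcl (ρ-cl x))

  cl-least : IsFlat F → w ≼ F → cl w ≼ F
  cl-least (_ , _ , F-greatest) w≼F with rank-preserving-join (≼-cl _) w≼F (ρ-cl _)
  ... | u , cl≼u , F≼u , ρu≡ρF = ≼-trans cl≼u (F-greatest u F≼u ρu≡ρF)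

  ρ-bot : ρ bot ≡ 0
  ρ-bot = ℕP.n≤0⇒n≡0 (subst (ρ bot ≤_) ∣bot∣≡0 (M1 bot))

  ρ≡0⇒≡bot : (∀ a → ¬ IsLoop a) → ρ z ≡ 0 → z ≡ bot
  ρ≡0⇒≡bot {z} loopless ρz≡0 = decidable-stable (z ≟ bot) λ z≢bot →
    let a , a-atom , a≼z , _ = atom-separating (bot-min z) (z≢bot ∘ ≼bot⇒≡bot)
    in loopless a (a-atom , ℕP.n≤0⇒n≡0 (subst (ρ a ≤_) ρz≡0 (M2 a≼z)))

module CharacteristicPolynomial (M : MatroidScheme) (loopless : ∀ a → ¬ MatroidScheme.IsLoop M a) where

  open MatroidScheme M renaming (refl to ≼-refl; trans to ≼-trans)
  open SimplicialPoset S simplicial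
  open Closure M
  open ≡.≡-Reasoning

  private variable
    F : Fin n

  fibre-sign : Fin n → ℤ
  fibre-sign G = ∑[ w < n ] (⟦ cl w ≟ G ⟧ * sign w)

  ∑-fibre-sign : (h : Fin n → ℤ) → ∑[ G < n ] (h G * fibre-sign G) ≡ ∑[ w < n ] (h (cl w) * sign w)
  ∑-fibre-sign h = ∑-fibres cl h sign

  flat-lower-sum-fibre-sign : IsFlat F → ∑[ G < n ] (⟦ isFlat? G ×-dec G ≼? F ⟧ * fibre-sign G) ≡ ⟦ F ≟ bot ⟧
  flat-lower-sum-fibre-sign {F} F-flat = begin
    ∑[ G < n ] (⟦ isFlat? G ×-dec G ≼? F ⟧ * fibre-sign G)
      ≡⟨ ∑-fibre-sign (λ G → ⟦ isFlat? G ×-dec G ≼? F ⟧) ⟩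
    ∑[ w < n ] (⟦ isFlat? (cl w) ×-dec cl w ≼? F ⟧ * sign w)
      ≡⟨ sum-cong-≗ (λ w → cong (_* sign w) (⟦⟧-⇔ (cl≼F⇔≼F w) (isFlat? (cl w) ×-dec cl w ≼? F) (w ≼? F))) ⟩
    ∑[ w < n ] (⟦ w ≼? F ⟧ * sign w)
      ≡⟨ ∑-sign-below F ⟩
    ⟦ F ≟ bot ⟧ ∎
    where
    cl≼F⇔≼F : ∀ w → (IsFlat (cl w) × cl w ≼ F) ⇔ w ≼ F
    cl≼F⇔≼F w = mk⇔ (λ (_ , cl≼F) → ≼-trans (≼-cl w) cl≼F) (λ w≼F → cl-flat w , cl-least F-flat w≼F)

  module _ {c μ} (c-closure : IsClosure bot c) (μ-mobius : IsMobiusF c μ) where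

    c≡bot : c ≡ bot
    c≡bot = ρ≡0⇒≡bot loopless (trans (proj₁ (proj₂ c-closure)) ρ-bot)

    flat-lower-sum-μ : IsFlat F → ∑[ G < n ] (⟦ isFlat? G ×-dec G ≼? F ⟧ * μ G) ≡ ⟦ F ≟ bot ⟧
    flat-lower-sum-μ {F} F-flat with F ≟ bot
    ... | yes refl = begin
      ∑[ G < n ] (⟦ isFlat? G ×-dec G ≼? bot ⟧ * μ G)
        ≡⟨ ∑-single _ bot (λ G G≢bot → ⟦⟧*-no (isFlat? G ×-dec G ≼? bot) (G≢bot ∘ ≼bot⇒≡bot ∘ proj₂)) ⟩
      ⟦ isFlat? bot ×-dec bot ≼? bot ⟧ * μ bot
        ≡⟨ ⟦⟧*-yes (isFlat? bot ×-dec bot ≼? bot) (F-flat , ≼-refl bot) ⟩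
      μ bot
        ≡⟨ subst (λ v → μ v ≡ 1ℤ) c≡bot (proj₁ μ-mobius) ⟩
      1ℤ ∎
    ... | no F≢bot = begin
      ∑[ G < n ] (⟦ isFlat? G ×-dec G ≼? F ⟧ * μ G)
        ≡⟨ foldr-filter-allFin (λ G → isFlat? G ×-dec G ≼? F) μ ⟨
      Σ[ n ∣ (λ G → isFlat? G ×-dec G ≼? F) ] μ
        ≡⟨ proj₂ μ-mobius F F-flat (subst (_≼ F) (sym c≡bot) (bot-min F) , c≢F) ⟩
      0ℤ ∎
      where
      c≢F : c ≢ F
      c≢F c≡F = F≢bot (trans (sym c≡F) c≡bot)

    μ≡fibre-sign : ∀ F → IsFlat F → μ F ≡ fibre-sign F
    μ≡fibre-sign = lower-sums-determine isFlat? μ fibre-sign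
      (λ F F-flat → trans (flat-lower-sum-μ F-flat) (sym (flat-lower-sum-fibre-sign F-flat)))

    χF-expansion : ∀ m t → χF μ m t ≡ ∑[ w < n ] (sign w * t ^ (ρ m ∸ ρ w))
    χF-expansion m t = begin
      χF μ m t
        ≡⟨ foldr-filter-allFin isFlat? (λ G → μ G * T G) ⟩
      ∑[ G < n ] (⟦ isFlat? G ⟧ * (μ G * T G))
        ≡⟨ sum-cong-≗ (λ G → ⟦⟧*-cong (isFlat? G) (λ G-flat → cong (_* T G) (μ≡fibre-sign G G-flat))) ⟩
      ∑[ G < n ] (⟦ isFlat? G ⟧ * (fibre-sign G * T G))
        ≡⟨ sum-cong-≗ (λ G → rearrange ⟦ isFlat? G ⟧ (fibre-sign G) (T G)) ⟩
      ∑[ G < n ] (⟦ isFlat? G ⟧ * T G * fibre-sign G)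
        ≡⟨ ∑-fibre-sign (λ G → ⟦ isFlat? G ⟧ * T G) ⟩
      ∑[ w < n ] (⟦ isFlat? (cl w) ⟧ * T (cl w) * sign w)
        ≡⟨ sum-cong-≗ (λ w → cong (_* sign w) (⟦⟧*-yes (isFlat? (cl w)) (cl-flat w))) ⟩
      ∑[ w < n ] (T (cl w) * sign w)
        ≡⟨ sum-cong-≗ (λ w → trans (cong (λ r → t ^ (ρ m ∸ r) * sign w) (ρ-cl w)) (ℤP.*-comm (T w) (sign w))) ⟩
      ∑[ w < n ] (sign w * T w) ∎
      where
      T : Fin n → ℤ
      T w = t ^ (ρ m ∸ ρ w)
      rearrange : ∀ a b c → a * (b * c) ≡ a * c * b
      rearrange = solve 3 (λ a b c → a :* (b :* c) := a :* c :* b) refl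
        where open +-*-Solver

  tutte-expansion : ∀ {m} → IsMaximal m → ∀ t →
    (- (+ 1)) ^ ρ m * Tutte m (+ 1 - t) (+ 0) ≡ ∑[ w < n ] (sign w * t ^ (ρ m ∸ ρ w))
  tutte-expansion {m} m-maximal t = begin
    -1ℤ ^ ρ m * Tutte m (1ℤ - t) 0ℤ
      ≡⟨ cong (-1ℤ ^ ρ m *_) (foldr-filter-allFin (λ _ → yes tt) summand) ⟩
    -1ℤ ^ ρ m * ∑[ w < n ] (1ℤ * summand w)
      ≡⟨ *-distribˡ-sum (-1ℤ ^ ρ m) (λ w → 1ℤ * summand w) ⟩
    ∑[ w < n ] (-1ℤ ^ ρ m * (1ℤ * summand w))
      ≡⟨ sum-cong-≗ (λ w → cong (-1ℤ ^ ρ m *_) (ℤP.*-identityˡ (summand w))) ⟩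
    ∑[ w < n ] (-1ℤ ^ ρ m * summand w)
      ≡⟨ sum-cong-≗ signed-summand ⟩
    ∑[ w < n ] (sign w * t ^ (ρ m ∸ ρ w)) ∎
    where
    summand : Fin n → ℤ
    summand w = (1ℤ - t - 1ℤ) ^ (ρ m ∸ ρ w) * (0ℤ - 1ℤ) ^ (∣ w ∣ ∸ ρ w)
    signed-summand : ∀ w → -1ℤ ^ ρ m * summand w ≡ sign w * t ^ (ρ m ∸ ρ w)
    signed-summand w = subst₂ (λ r k → -1ℤ ^ r * summand w ≡ -1ℤ ^ k * t ^ (ρ m ∸ ρ w))
      (ℕP.m+[n∸m]≡n (ρ≤ρ-maximal m-maximal w)) (ℕP.m+[n∸m]≡n (M1 w))
      (tutte-summand-at-1-t (ρ w) (ρ m ∸ ρ w) (∣ w ∣ ∸ ρ w) t)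

theorem11p2 : (M : MatroidScheme) → let open MatroidScheme M in
    (∀ a → ¬ IsLoop a) →
    ∀ (m : Fin n) → IsMaximal m →
    ∀ (c : Fin n) → IsClosure bot c →
    ∀ (μ : Fin n → ℤ) → IsMobiusF c μ →
    ∀ (t : ℤ) → χF μ m t ≡ (- (+ 1)) ^ ρ m * Tutte m (+ 1 - t) (+ 0)
theorem11p2 M loopless m m-maximal c c-closure μ μ-mobius t = begin
  χF μ m t                                      ≡⟨ χF-expansion c-closure μ-mobius m t ⟩
  ∑[ w < n ] (sign w * t ^ (ρ m ∸ ρ w))         ≡⟨ tutte-expansion m-maximal t ⟨
  (- (+ 1)) ^ ρ m * Tutte m (+ 1 - t) (+ 0)     ∎
  where
  open MatroidScheme M
  open SimplicialPoset S simplicial using (sign)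
  open CharacteristicPolynomial M loopless
  open ≡.≡-Reasoning
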